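{- Let $\ell\ge r\ge 3$, $\binom{\ell}{2}\le k<\frac{\ell^2-1}{2}$, and fix integers $t\ge 1$ and $b\ge 0$. For $n$ sufficiently large the following holds. Let $\mathcal{H}_1,\dots,\mathcal{H}_k$ be $r$-graphs on a common vertex set $V$ with $|V|=n$ containing no rainbow copy of $K_\ell^{(r)+}$, and suppose $\min_{v\in V} m(v)\geq \left(\binom{\ell}{2}-1\right)\binom{n-1}{r-1}$. Then for every $T\subseteq V$ with $|T|=t$ and every $B\subseteq V$ with $|B|=b$, the $(r-1)$-graph $\mathcal{H}(T)$ contains a sunflower with $t$ petals whose kernel is a single vertex of $V\setminus T$, all of whose sets are contained in $V\setminus T$ and are disjoint from $B$.
   Context: An $r$-graph is an $r$-uniform hypergraph. $K_\ell^{(r)+}$ is the $r$-expansion of the complete graph $K_\ell$: each edge of $K_\ell$ is enlarged by $r-2$ new vertices, all new vertices distinct from each other and from the $\ell$ original vertices. $r$-graphs $\mathcal{H}_1,\dots,\mathcal{H}_k$ on a common vertex set contain a rainbow copy of $\mathcal{F}$ if their union contains a copy of $\mathcal{F}$ whose hyperedges lie in pairwise distinct $\mathcal{H}_i$'s. For an $r$-subset $E\subseteq V$, its multiplicity $m(E)$ is the number of indices $i$ with $E\in E(\mathcal{H}_i)$; for $v\in V$, $m(v)=\sum_{E\ni v}m(E)$. For $T\subseteq V$ with $|T|=t$, an $(r-1)$-subset $A\subseteq V\setminus T$ fits $T$ if $\sum_{E:\,|E\cap T|=1,\ A\subseteq E}m(E)\geq t\left(\binom{\ell}{2}-1\right)$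 (sum over $r$-subsets $E$ of $V$), and $\mathcal{H}(T)$ is the $(r-1)$-graph of all $(r-1)$-subsets of $V\setminus T$ that fit $T$. A sunflower with $t$ petals and kernel $\{w\}$ is a family of $t$ distinct sets any two of which intersect exactly in $\{w\}$. -}

module Defs where

open import Data.Nat using (ℕ; zero; suc; _+_; _*_; _∸_; _≤_; _<_; _≥_)
open import Data.Nat.Properties using (_≟_)
open import Data.Nat.Combinatorics using (_C_)
open import Data.Bool using (Bool; true; false; _∧_)
open import Data.Fin using (Fin)
import Data.Fin.Properties as FinP
open import Data.Fin.Subset using (Subset; ∣_∣; _∈_; _∉_; _⊆_; _∩_; ⁅_⁆; inside; outside)
open import Data.Fin.Subset.Properties using (_∈?_; _⊆?_)
open import Data.List using (List; []; _∷_; _++_; map; filterᵇ; length; allFin)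
open import Data.Nat.ListAction using (sum)
open import Data.Vec using (Vec; []; _∷_)
open import Data.Product using (Σ; _×_; ∃; _,_)
open import Data.Sum using (_⊎_)
open import Relation.Nullary using (¬_; does)
open import Relation.Binary.PropositionalEquality using (_≡_; _≢_)

allSubsets : (n : ℕ) → List (Subset n)
allSubsets zero = [] ∷ []
allSubsets (suc n) = map (inside ∷_) (allSubsets n) ++ map (outside ∷_) (allSubsets n)

Family : ℕ → ℕ → Set
Family k n = Fin k → Subset n → Bool

Uniform : ∀ {k n} → ℕ → Family k n → Set
Uniform {k} {n} r H = ∀ (i : Fin k) (E : Subset n) → H i E ≡ true → ∣ E ∣ ≡ r

mult : ∀ {k n} → Family k n → Subset n → ℕ
mult {k} H E = length (filterᵇ (λ i → H i E) (allFin k))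

hasSize : ∀ {n} → ℕ → Subset n → Bool
hasSize r E = does (∣ E ∣ ≟ r)

multV : ∀ {k n} → ℕ → Family k n → Fin n → ℕ
multV {k} {n} r H v =
  sum (map (mult H) (filterᵇ (λ E → hasSize r E ∧ does (v ∈? E)) (allSubsets n)))

fitSum : ∀ {k n} → ℕ → Family k n → Subset n → Subset n → ℕ
fitSum {k} {n} r H T A =
  sum (map (mult H)
    (filterᵇ (λ E → hasSize r E ∧ (does (∣ E ∩ T ∣ ≟ 1) ∧ does (A ⊆? E))) (allSubsets n)))

Disjoint : ∀ {n} → Subset n → Subset n → Set
Disjoint {n} X Y = ∀ (x : Fin n) → x ∈ X → x ∉ Y

InHT : ∀ {k n} → (ℓ r t : ℕ) → Family k n → Subset n → Subset n → Set
InHT ℓ r t H T A =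
  ∣ A ∣ ≡ r ∸ 1 × Disjoint A T × fitSum r H T A ≥ t * ((ℓ C 2) ∸ 1)

-- The family contains a rainbow copy of K_ℓ^{(r)+}:
-- core vertices f (injective), for each pair a < b of core indices an edge e a b
-- of colour c a b with E ∈ H_{c a b}, containing f a and f b, meeting the core only
-- in {f a, f b}, two different such edges meeting only inside the core, and the
-- colours pairwise distinct.
RainbowExpansion : ∀ {k n} → (ℓ r : ℕ) → Family k n → Set
RainbowExpansion {k} {n} ℓ r H =
  Σ (Fin ℓ → Fin n) λ f →
  Σ ((a b : Fin ℓ) → Data.Fin._<_ a b → Subset n) λ e →
  Σ ((a b : Fin ℓ) → Data.Fin._<_ a b → Fin k) λ c →
    (∀ a a′ → f a ≡ f a′ → a ≡ a′)
    × (∀ a b (p : Data.Fin._<_ a b) →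
         H (c a b p) (e a b p) ≡ true
         × ∣ e a b p ∣ ≡ r
         × f a ∈ e a b p × f b ∈ e a b p
         × (∀ (d : Fin ℓ) → f d ∈ e a b p → d ≡ a ⊎ d ≡ b))
    × (∀ a b (p : Data.Fin._<_ a b) a′ b′ (p′ : Data.Fin._<_ a′ b′) →
         (a ≢ a′ ⊎ b ≢ b′) →
         c a b p ≢ c a′ b′ p′
         × (∀ (x : Fin n) → x ∈ e a b p → x ∈ e a′ b′ p′ → ∃ λ d → x ≡ f d))

SunflowerInHT : ∀ {k n} → (ℓ r t : ℕ) → Family k n → Subset n → Subset n → Set
SunflowerInHT {k} {n} ℓ r t H T B =
  Σ (Fin n) λ w → Σ (Fin t → Subset n) λ S →
    w ∉ T
    × (∀ j j′ → S j ≡ S j′ → j ≡ j′)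
    × (∀ j → InHT ℓ r t H T (S j) × w ∈ S j × Disjoint (S j) B)
    × (∀ j j′ → j ≢ j′ → S j ∩ S j′ ≡ ⁅ w ⁆)

-- Let W = T ∪ B and c = C(ℓ,2) − 1. Summing the degree condition over T, every r-set meeting W only in
-- one vertex of T passes its multiplicity on to fitSum of its (r−1)-set outside T, while the r-sets
-- meeting W twice are only O(n^(r−2)). As fitSum A ≤ k t for every (r−1)-set A avoiding W, and
-- fitSum A < t c unless A fits T, a positive proportion of the C(n − |W|, r − 1) sets avoiding W fit T.
-- So some vertex w lies in more fitting sets than there are (r−1)-sets meeting a set of size
-- 1 + t(r−1) twice, and t petals through w can be chosen greedily.

module Submission where

open import Defs
open import Data.Bool using (Bool; true; false; _∧_)
open import Data.Bool.Properties using (∧-conicalˡ; ∧-conicalʳ; ∧-zeroʳ; ∧-identityʳ)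
open import Data.Empty using (⊥-elim)
open import Data.Fin using (Fin; zero; suc; fromℕ<)
import Data.Fin.Properties as Finₚ
open import Data.Fin.Subset using (Subset; ∣_∣; _∈_; _∉_; _⊆_; _∩_; _∪_; _─_; ⁅_⁆; inside; outside)
open import Data.Fin.Subset.Properties using (_∈?_; _⊆?_)
import Data.Fin.Subset.Properties as Subsetₚ
open import Data.List using ([]; _∷_; _++_; map; filterᵇ; allFin)
import Data.List.Properties as Listₚ
open import Data.Nat
open import Data.Nat.DivMod using (_/_; _%_; m≡m%n+[m/n]*n; m%n<n; m/n*n≤m; m*n/n≡m; /-monoˡ-≤)
open import Data.Nat.Combinatorics using (_C_; nCk+nC[k+1]≡[n+1]C[k+1])
open import Data.Nat.ListAction using (sum)
open import Data.Nat.ListAction.Properties using (sum-++)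
open import Data.Nat.Properties
open import Data.Nat.Tactic.RingSolver using (solve-∀)
open import Data.Product using (Σ; _×_; ∃; _,_; proj₁; proj₂)
open import Data.Sum using (_⊎_; inj₁; inj₂)
open import Data.Vec using ([]; _∷_; lookup; here; there)
import Data.Vec.Properties as Vecₚ
open import Function using (_∘_)
open import Relation.Nullary using (¬_; Dec; does; yes; no; contradiction)
open import Relation.Nullary.Decidable using (dec-true; dec-false)
open import Relation.Binary.PropositionalEquality
open import Algebra.Properties.CommutativeSemigroup +-commutativeSemigroup
  using () renaming (interchange to +-interchange; xy∙z≈xz∙y to [x+y]+z≡[x+z]+y)
open import Algebra.Properties.CommutativeSemigroup *-commutativeSemigroup
  using () renaming (interchange to *-interchange)

𝟙 : Bool → ℕ
𝟙 true  = 1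
𝟙 false = 0

𝟙≤1 : ∀ b → 𝟙 b ≤ 1
𝟙≤1 true  = ≤-refl
𝟙≤1 false = z≤n

𝟙-∧ : ∀ a b → 𝟙 (a ∧ b) ≡ 𝟙 a * 𝟙 b
𝟙-∧ true  b = sym (+-identityʳ (𝟙 b))
𝟙-∧ false b = refl

𝟙[a∧b∧c]≡0 : ∀ a b c → (c ≡ true → a ≡ false) → 𝟙 (a ∧ (b ∧ c)) ≡ 0
𝟙[a∧b∧c]≡0 false b c       _     = refl
𝟙[a∧b∧c]≡0 true  b false   _     = cong 𝟙 (∧-zeroʳ b)
𝟙[a∧b∧c]≡0 true  b true    c⇒¬a with () ← c⇒¬a refl

does≡true⇒ : ∀ {A : Set} (a? : Dec A) → does a? ≡ true → A
does≡true⇒ (yes a) _ = a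

does≡false⇒¬ : ∀ {A : Set} (a? : Dec A) → does a? ≡ false → ¬ A
does≡false⇒¬ (no ¬a) _ = ¬a

∧-intro : ∀ {a b} → a ≡ true → b ≡ true → a ∧ b ≡ true
∧-intro refl refl = refl

+-<-split : ∀ a b c d → a + b < c + d → a < c ⊎ b < d
+-<-split a b c d a+b<c+d with a <? c
... | yes a<c = inj₁ a<c
... | no  a≮c = inj₂ (+-cancelˡ-< c b d (≤-trans (+-monoˡ-< b (≰⇒> a≮c)) a+b<c+d))

-- Sums over subsets and over vertices

∑ₛ : ∀ {n} → (Subset n → ℕ) → ℕ
∑ₛ {zero}  f = f []
∑ₛ {suc n} f = ∑ₛ (f ∘ (inside ∷_)) + ∑ₛ (f ∘ (outside ∷_))

∑ₛ-cong : ∀ {n} {f g : Subset n → ℕ} → (∀ E → f E ≡ g E) → ∑ₛ f ≡ ∑ₛ g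
∑ₛ-cong {zero}  f≗g = f≗g []
∑ₛ-cong {suc n} f≗g = cong₂ _+_ (∑ₛ-cong (f≗g ∘ (inside ∷_))) (∑ₛ-cong (f≗g ∘ (outside ∷_)))

∑ₛ-mono-≤ : ∀ {n} {f g : Subset n → ℕ} → (∀ E → f E ≤ g E) → ∑ₛ f ≤ ∑ₛ g
∑ₛ-mono-≤ {zero}  f≤g = f≤g []
∑ₛ-mono-≤ {suc n} f≤g = +-mono-≤ (∑ₛ-mono-≤ (f≤g ∘ (inside ∷_))) (∑ₛ-mono-≤ (f≤g ∘ (outside ∷_)))

∑ₛ≡0 : ∀ {n} {f : Subset n → ℕ} → (∀ E → f E ≡ 0) → ∑ₛ f ≡ 0
∑ₛ≡0 {zero}  f≗0 = f≗0 []
∑ₛ≡0 {suc n} f≗0 = cong₂ _+_ (∑ₛ≡0 (f≗0 ∘ (inside ∷_))) (∑ₛ≡0 (f≗0 ∘ (outside ∷_)))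

∑ₛ-distrib-+ : ∀ {n} (f g : Subset n → ℕ) → ∑ₛ (λ E → f E + g E) ≡ ∑ₛ f + ∑ₛ g
∑ₛ-distrib-+ {zero}  f g = refl
∑ₛ-distrib-+ {suc n} f g = trans
  (cong₂ _+_ (∑ₛ-distrib-+ (f ∘ (inside ∷_)) (g ∘ (inside ∷_))) (∑ₛ-distrib-+ (f ∘ (outside ∷_)) (g ∘ (outside ∷_))))
  (+-interchange (∑ₛ (f ∘ (inside ∷_))) _ _ _)

∑ₛ-distribˡ-* : ∀ {n} c (f : Subset n → ℕ) → ∑ₛ (λ E → c * f E) ≡ c * ∑ₛ f
∑ₛ-distribˡ-* {zero}  c f = refl
∑ₛ-distribˡ-* {suc n} c f =
  trans (cong₂ _+_ (∑ₛ-distribˡ-* c (f ∘ (inside ∷_))) (∑ₛ-distribˡ-* c (f ∘ (outside ∷_))))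
        (sym (*-distribˡ-+ c (∑ₛ (f ∘ (inside ∷_))) _))

∑ₛ-comm : ∀ {m n} (h : Subset m → Subset n → ℕ) →
  ∑ₛ (λ A → ∑ₛ (λ E → h A E)) ≡ ∑ₛ (λ E → ∑ₛ (λ A → h A E))
∑ₛ-comm {zero}  h = refl
∑ₛ-comm {suc m} h =
  trans (cong₂ _+_ (∑ₛ-comm (h ∘ (inside ∷_))) (∑ₛ-comm (h ∘ (outside ∷_))))
        (sym (∑ₛ-distrib-+ (λ E → ∑ₛ (λ A → h (inside ∷ A) E)) (λ E → ∑ₛ (λ A → h (outside ∷ A) E))))

term≤∑ₛ : ∀ {n} (f : Subset n → ℕ) X → f X ≤ ∑ₛ f
term≤∑ₛ {zero}  f []           = ≤-refl
term≤∑ₛ {suc n} f (inside ∷ X)  = ≤-trans (term≤∑ₛ (f ∘ (inside ∷_)) X) (m≤m+n _ _)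
term≤∑ₛ {suc n} f (outside ∷ X) = ≤-trans (term≤∑ₛ (f ∘ (outside ∷_)) X) (m≤n+m _ _)

∑ₛ-pigeonhole : ∀ {n} (g f : Subset n → ℕ) → ∑ₛ g < ∑ₛ f → ∃ λ X → g X < f X
∑ₛ-pigeonhole {zero}  g f g<f = [] , g<f
∑ₛ-pigeonhole {suc n} g f g<f with +-<-split _ _ _ _ g<f
... | inj₁ gᵢ<fᵢ = let X , p = ∑ₛ-pigeonhole (g ∘ (inside ∷_)) (f ∘ (inside ∷_)) gᵢ<fᵢ in inside ∷ X , p
... | inj₂ gₒ<fₒ = let X , p = ∑ₛ-pigeonhole (g ∘ (outside ∷_)) (f ∘ (outside ∷_)) gₒ<fₒ in outside ∷ X , p

∑ᵢ : ∀ {n} → (Fin n → ℕ) → ℕ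
∑ᵢ {zero}  f = 0
∑ᵢ {suc n} f = f zero + ∑ᵢ (f ∘ suc)

∑ᵢ-cong : ∀ {n} {f g : Fin n → ℕ} → (∀ v → f v ≡ g v) → ∑ᵢ f ≡ ∑ᵢ g
∑ᵢ-cong {zero}  f≗g = refl
∑ᵢ-cong {suc n} f≗g = cong₂ _+_ (f≗g zero) (∑ᵢ-cong (f≗g ∘ suc))

∑ᵢ-mono-≤ : ∀ {n} {f g : Fin n → ℕ} → (∀ v → f v ≤ g v) → ∑ᵢ f ≤ ∑ᵢ g
∑ᵢ-mono-≤ {zero}  f≤g = z≤n
∑ᵢ-mono-≤ {suc n} f≤g = +-mono-≤ (f≤g zero) (∑ᵢ-mono-≤ (f≤g ∘ suc))

∑ᵢ-distribʳ-* : ∀ {n} c (f : Fin n → ℕ) → ∑ᵢ (λ v → f v * c) ≡ ∑ᵢ f * c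
∑ᵢ-distribʳ-* {zero}  c f = refl
∑ᵢ-distribʳ-* {suc n} c f =
  trans (cong (f zero * c +_) (∑ᵢ-distribʳ-* c (f ∘ suc))) (sym (*-distribʳ-+ c (f zero) _))

∑ᵢ-pigeonhole : ∀ {n} D (f : Fin n → ℕ) → n * D < ∑ᵢ f → ∃ λ v → D < f v
∑ᵢ-pigeonhole {suc n} D f nD<∑f with +-<-split D (n * D) (f zero) (∑ᵢ (f ∘ suc)) nD<∑f
... | inj₁ D<f₀ = zero , D<f₀
... | inj₂ rest = let v , p = ∑ᵢ-pigeonhole D (f ∘ suc) rest in suc v , p

∑ᵢ-∑ₛ-comm : ∀ {m n} (h : Fin m → Subset n → ℕ) →
  ∑ᵢ (λ v → ∑ₛ (h v)) ≡ ∑ₛ (λ E → ∑ᵢ (λ v → h v E))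
∑ᵢ-∑ₛ-comm {zero}  {n} h = sym (∑ₛ≡0 {n} λ _ → refl)
∑ᵢ-∑ₛ-comm {suc m} {n} h =
  trans (cong (∑ₛ (h zero) +_) (∑ᵢ-∑ₛ-comm (h ∘ suc)))
        (sym (∑ₛ-distrib-+ (h zero) (λ E → ∑ᵢ (λ v → h (suc v) E))))

∑ᵢ-𝟙-lookup≡∣_∣ : ∀ {n} (X : Subset n) → ∑ᵢ (λ v → 𝟙 (lookup X v)) ≡ ∣ X ∣
∑ᵢ-𝟙-lookup≡∣_∣ []            = refl
∑ᵢ-𝟙-lookup≡∣_∣ (inside ∷ X)  = cong suc (∑ᵢ-𝟙-lookup≡∣_∣ X)
∑ᵢ-𝟙-lookup≡∣_∣ (outside ∷ X) = ∑ᵢ-𝟙-lookup≡∣_∣ X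

sum-filter-allSubsets : ∀ {n} (p : Subset n → Bool) (g : Subset n → ℕ) →
  sum (map g (filterᵇ p (allSubsets n))) ≡ ∑ₛ (λ E → 𝟙 (p E) * g E)
sum-filter-allSubsets {n} p g = trans (sum-filter (allSubsets n)) (sum-allSubsets (λ E → 𝟙 (p E) * g E))
  where
  sum-filter : ∀ L → sum (map g (filterᵇ p L)) ≡ sum (map (λ E → 𝟙 (p E) * g E) L)
  sum-filter []      = refl
  sum-filter (E ∷ L) with p E
  ... | true  = cong₂ _+_ (sym (+-identityʳ (g E))) (sum-filter L)
  ... | false = sum-filter L
  sum-allSubsets : ∀ {m} (f : Subset m → ℕ) → sum (map f (allSubsets m)) ≡ ∑ₛ f
  sum-allSubsets {zero}  f = +-identityʳ (f [])
  sum-allSubsets {suc m} f = begin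
    sum (map f (map (inside ∷_) L ++ map (outside ∷_) L))
      ≡⟨ cong sum (Listₚ.map-++ f (map (inside ∷_) L) _) ⟩
    sum (map f (map (inside ∷_) L) ++ map f (map (outside ∷_) L))
      ≡⟨ sum-++ (map f (map (inside ∷_) L)) _ ⟩
    sum (map f (map (inside ∷_) L)) + sum (map f (map (outside ∷_) L))
      ≡⟨ cong₂ _+_ (cong sum (Listₚ.map-∘ L)) (cong sum (Listₚ.map-∘ L)) ⟨
    sum (map (f ∘ (inside ∷_)) L) + sum (map (f ∘ (outside ∷_)) L)
      ≡⟨ cong₂ _+_ (sum-allSubsets (f ∘ (inside ∷_))) (sum-allSubsets (f ∘ (outside ∷_))) ⟩
    ∑ₛ f ∎
    where
    open ≡-Reasoning
    L = allSubsets m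

mult≤k : ∀ {k n} (H : Family k n) E → mult H E ≤ k
mult≤k {k} H E = ≤-trans (Listₚ.length-filter _ (allFin k)) (≤-reflexive (Listₚ.length-tabulate {n = k} (λ i → i)))

multV≡∑ₛ : ∀ {k n} r (H : Family k n) v →
  multV r H v ≡ ∑ₛ (λ E → 𝟙 (hasSize r E ∧ lookup E v) * mult H E)
multV≡∑ₛ r H v = trans (sum-filter-allSubsets _ (mult H))
  (∑ₛ-cong (λ E → cong (λ b → 𝟙 (hasSize r E ∧ b) * mult H E) (does-∈?≡lookup v E)))
  where
  does-∈?≡lookup : ∀ {n} (v : Fin n) (X : Subset n) → does (v ∈? X) ≡ lookup X v
  does-∈?≡lookup zero    (inside ∷ X)  = refl
  does-∈?≡lookup zero    (outside ∷ X) = refl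
  does-∈?≡lookup (suc v) (x ∷ X)       = does-∈?≡lookup v X

∑ᵢ-multV≡∑ₛ : ∀ {k n} r (H : Family k n) (T : Subset n) →
  ∑ᵢ (λ v → 𝟙 (lookup T v) * multV r H v) ≡ ∑ₛ (λ E → ∣ E ∩ T ∣ * (𝟙 (hasSize r E) * mult H E))
∑ᵢ-multV≡∑ₛ {n = n} r H T = begin
  ∑ᵢ (λ v → 𝟙 (lookup T v) * multV r H v)
    ≡⟨ ∑ᵢ-cong (λ v → trans (cong (𝟙 (lookup T v) *_) (multV≡∑ₛ r H v))
                            (sym (∑ₛ-distribˡ-* {n} (𝟙 (lookup T v)) _))) ⟩
  ∑ᵢ (λ v → ∑ₛ (λ E → 𝟙 (lookup T v) * (𝟙 (hasSize r E ∧ lookup E v) * mult H E)))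
    ≡⟨ ∑ᵢ-∑ₛ-comm {n} {n} _ ⟩
  ∑ₛ (λ E → ∑ᵢ (λ v → 𝟙 (lookup T v) * (𝟙 (hasSize r E ∧ lookup E v) * mult H E)))
    ≡⟨ ∑ₛ-cong (λ E → trans (∑ᵢ-cong (term E))
                            (trans (∑ᵢ-distribʳ-* {n} _ _) (cong (_* _) (∑ᵢ-𝟙-lookup≡∣ E ∩ T ∣)))) ⟩
  ∑ₛ (λ E → ∣ E ∩ T ∣ * (𝟙 (hasSize r E) * mult H E)) ∎
  where
  open ≡-Reasoning
  reorder : ∀ a e h m → a * ((h * e) * m) ≡ (e * a) * (h * m)
  reorder = solve-∀
  term : ∀ E v → 𝟙 (lookup T v) * (𝟙 (hasSize r E ∧ lookup E v) * mult H E)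
               ≡ 𝟙 (lookup (E ∩ T) v) * (𝟙 (hasSize r E) * mult H E)
  term E v = begin
    𝟙 (lookup T v) * (𝟙 (hasSize r E ∧ lookup E v) * mult H E)
      ≡⟨ cong (λ x → 𝟙 (lookup T v) * (x * mult H E)) (𝟙-∧ (hasSize r E) (lookup E v)) ⟩
    𝟙 (lookup T v) * ((𝟙 (hasSize r E) * 𝟙 (lookup E v)) * mult H E)
      ≡⟨ reorder (𝟙 (lookup T v)) (𝟙 (lookup E v)) (𝟙 (hasSize r E)) (mult H E) ⟩
    (𝟙 (lookup E v) * 𝟙 (lookup T v)) * (𝟙 (hasSize r E) * mult H E)
      ≡⟨ cong (_* _) (trans (sym (𝟙-∧ (lookup E v) (lookup T v)))
                            (cong 𝟙 (sym (Vecₚ.lookup-zipWith _∧_ v E T)))) ⟩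
    𝟙 (lookup (E ∩ T) v) * (𝟙 (hasSize r E) * mult H E) ∎

-- Binomial coefficients by Pascal's rule, which is the recursion that induction over Subset n produces;
-- choose≡C identifies them with _C_.
choose : ℕ → ℕ → ℕ
choose n       zero    = 1
choose zero    (suc k) = 0
choose (suc n) (suc k) = choose n k + choose n (suc k)

choose≡C : ∀ n k → choose n k ≡ n C k
choose≡C n       zero    = refl
choose≡C zero    (suc k) = refl
choose≡C (suc n) (suc k) = trans (cong₂ _+_ (choose≡C n k) (choose≡C n (suc k))) (nCk+nC[k+1]≡[n+1]C[k+1] n k)

choose[n,k]≤choose[1+n,k] : ∀ n k → choose n k ≤ choose (suc n) k
choose[n,k]≤choose[1+n,k] n zero    = ≤-refl
choose[n,k]≤choose[1+n,k] n (suc k) = m≤n+m _ _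

choose-monoˡ-≤ : ∀ k {m n} → m ≤ n → choose m k ≤ choose n k
choose-monoˡ-≤ k {n = zero}  z≤n = ≤-refl
choose-monoˡ-≤ k {n = suc n} m≤1+n with m≤n⇒m<n∨m≡n m≤1+n
... | inj₁ m<1+n = ≤-trans (choose-monoˡ-≤ k (≤-pred m<1+n)) (choose[n,k]≤choose[1+n,k] n k)
... | inj₂ refl  = ≤-refl

choose≤^ : ∀ n k → choose n k ≤ n ^ k
choose≤^ n       zero    = ≤-refl
choose≤^ zero    (suc k) = z≤n
choose≤^ (suc n) (suc k) = begin
  choose n k + choose n (suc k) ≤⟨ +-mono-≤ (choose≤^ n k) (choose≤^ n (suc k)) ⟩
  n ^ k + n * n ^ k             ≤⟨ +-monoʳ-≤ (n ^ k) (*-monoʳ-≤ n (^-monoˡ-≤ k (n≤1+n n))) ⟩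
  n ^ k + n * suc n ^ k         ≤⟨ +-monoˡ-≤ (n * suc n ^ k) (^-monoˡ-≤ k (n≤1+n n)) ⟩
  suc n ^ k + n * suc n ^ k     ∎
  where open ≤-Reasoning

a*choose[m,k]≤choose[a+m,1+k] : ∀ a m k → a * choose m k ≤ choose (a + m) (suc k)
a*choose[m,k]≤choose[a+m,1+k] zero    m k = z≤n
a*choose[m,k]≤choose[a+m,1+k] (suc a) m k =
  +-mono-≤ (choose-monoˡ-≤ k (m≤n+m m a)) (a*choose[m,k]≤choose[a+m,1+k] a m k)

a^k≤choose[k*a,k] : ∀ a k → a ^ k ≤ choose (k * a) k
a^k≤choose[k*a,k] a zero    = ≤-refl
a^k≤choose[k*a,k] a (suc k) =
  ≤-trans (*-monoʳ-≤ a (a^k≤choose[k*a,k] a k)) (a*choose[m,k]≤choose[a+m,1+k] a (k * a) k)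

[m*n]^k≡m^k*n^k : ∀ m n k → (m * n) ^ k ≡ m ^ k * n ^ k
[m*n]^k≡m^k*n^k m n zero    = refl
[m*n]^k≡m^k*n^k m n (suc k) = trans (cong (m * n *_) ([m*n]^k≡m^k*n^k m n k)) (*-interchange m n (m ^ k) (n ^ k))

-- With a = ⌊(n − P)/(q+1)⌋ we have n ≤ γ a for a constant γ, and choose (n − P) (q+1) ≥ a^(q+1),
-- which beats α (γ a)^q as soon as a > α γ^q.
choose-dominates-^ : ∀ α P q → ∃ λ n₀ → ∀ n → n₀ ≤ n → α * n ^ q < choose (n ∸ P) (suc q)
choose-dominates-^ α P q = P + s * a₀ , dominated
  where
  s γ a₀ : ℕ
  s  = suc q
  γ  = P + s + s
  a₀ = suc (α * γ ^ q)
  dominated : ∀ n → P + s * a₀ ≤ n → α * n ^ q < choose (n ∸ P) s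
  dominated n n₀≤n = begin-strict
    α * n ^ q           ≤⟨ *-monoʳ-≤ α (^-monoˡ-≤ q n≤γ*a) ⟩
    α * (γ * a) ^ q     ≡⟨ trans (cong (α *_) ([m*n]^k≡m^k*n^k γ a q)) (sym (*-assoc α (γ ^ q) (a ^ q))) ⟩
    α * γ ^ q * a ^ q   <⟨ *-monoˡ-< (a ^ q) {{>-nonZero (m^n>0 a {{a≢0}} q)}} a₀≤a ⟩
    a * a ^ q           ≤⟨ a^k≤choose[k*a,k] a s ⟩
    choose (s * a) s    ≤⟨ choose-monoˡ-≤ s (≤-trans (≤-reflexive (*-comm s a)) (m/n*n≤m (n ∸ P) s)) ⟩
    choose (n ∸ P) s    ∎
    where
    open ≤-Reasoning
    a = (n ∸ P) / s
    a₀≤a : a₀ ≤ a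
    a₀≤a = begin
      a₀          ≡⟨ m*n/n≡m a₀ s ⟨
      a₀ * s / s  ≤⟨ /-monoˡ-≤ s (≤-trans (≤-reflexive (*-comm a₀ s)) s*a₀≤n∸P) ⟩
      (n ∸ P) / s ∎
      where
      s*a₀≤n∸P = m+n≤o⇒m≤o∸n (s * a₀) (≤-trans (≤-reflexive (+-comm (s * a₀) P)) n₀≤n)
    1≤a : 1 ≤ a
    1≤a = ≤-trans (s≤s z≤n) a₀≤a
    a≢0 : NonZero a
    a≢0 = >-nonZero 1≤a
    n≤γ*a : n ≤ γ * a
    n≤γ*a = begin
      n                                    ≤⟨ m≤n+m∸n n P ⟩
      P + (n ∸ P)                          ≡⟨ cong (P +_) (m≡m%n+[m/n]*n (n ∸ P) s) ⟩
      P + ((n ∸ P) % s + a * s)            ≤⟨ +-monoʳ-≤ P (+-monoˡ-≤ (a * s) (<⇒≤ (m%n<n (n ∸ P) s))) ⟩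
      P + (s + a * s)                      ≤⟨ +-mono-≤ (m≤m*n P a {{a≢0}}) (+-monoˡ-≤ (a * s) (m≤m*n s a {{a≢0}})) ⟩
      P * a + (s * a + a * s)              ≡⟨ regroup P s a ⟩
      γ * a                                ∎
      where
      regroup : ∀ P s a → P * a + (s * a + a * s) ≡ (P + s + s) * a
      regroup = solve-∀

∣p∩q∣+∣p─q∣≡∣p∣ : ∀ {n} (p q : Subset n) → ∣ p ∩ q ∣ + ∣ p ─ q ∣ ≡ ∣ p ∣
∣p∩q∣+∣p─q∣≡∣p∣ []            []            = refl
∣p∩q∣+∣p─q∣≡∣p∣ (inside ∷ p)  (inside ∷ q)  = cong suc (∣p∩q∣+∣p─q∣≡∣p∣ p q)
∣p∩q∣+∣p─q∣≡∣p∣ (inside ∷ p)  (outside ∷ q) = trans (+-suc ∣ p ∩ q ∣ _) (cong suc (∣p∩q∣+∣p─q∣≡∣p∣ p q))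
∣p∩q∣+∣p─q∣≡∣p∣ (outside ∷ p) (inside ∷ q)  = ∣p∩q∣+∣p─q∣≡∣p∣ p q
∣p∩q∣+∣p─q∣≡∣p∣ (outside ∷ p) (outside ∷ q) = ∣p∩q∣+∣p─q∣≡∣p∣ p q

∣p∩q∣+∣[p─q]∩[q∪r]∣≡∣p∩[q∪r]∣ : ∀ {n} (p q r : Subset n) →
  ∣ p ∩ q ∣ + ∣ (p ─ q) ∩ (q ∪ r) ∣ ≡ ∣ p ∩ (q ∪ r) ∣
∣p∩q∣+∣[p─q]∩[q∪r]∣≡∣p∩[q∪r]∣ []            []            []            = refl
∣p∩q∣+∣[p─q]∩[q∪r]∣≡∣p∩[q∪r]∣ (inside ∷ p)  (inside ∷ q)  (_ ∷ r) =
  cong suc (∣p∩q∣+∣[p─q]∩[q∪r]∣≡∣p∩[q∪r]∣ p q r)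
∣p∩q∣+∣[p─q]∩[q∪r]∣≡∣p∩[q∪r]∣ (inside ∷ p)  (outside ∷ q) (inside ∷ r)  =
  trans (+-suc ∣ p ∩ q ∣ _) (cong suc (∣p∩q∣+∣[p─q]∩[q∪r]∣≡∣p∩[q∪r]∣ p q r))
∣p∩q∣+∣[p─q]∩[q∪r]∣≡∣p∩[q∪r]∣ (inside ∷ p)  (outside ∷ q) (outside ∷ r) =
  ∣p∩q∣+∣[p─q]∩[q∪r]∣≡∣p∩[q∪r]∣ p q r
∣p∩q∣+∣[p─q]∩[q∪r]∣≡∣p∩[q∪r]∣ (outside ∷ p) (inside ∷ q)  (_ ∷ r) =
  ∣p∩q∣+∣[p─q]∩[q∪r]∣≡∣p∩[q∪r]∣ p q r
∣p∩q∣+∣[p─q]∩[q∪r]∣≡∣p∩[q∪r]∣ (outside ∷ p) (outside ∷ q) (_ ∷ r) =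
  ∣p∩q∣+∣[p─q]∩[q∪r]∣≡∣p∩[q∪r]∣ p q r

p─q⊆p : ∀ {n} (p q : Subset n) → p ─ q ⊆ p
p─q⊆p (inside ∷ p) (outside ∷ q) here      = here
p─q⊆p (_ ∷ p)      (inside ∷ q)  (there x) = there (p─q⊆p p q x)
p─q⊆p (_ ∷ p)      (outside ∷ q) (there x) = there (p─q⊆p p q x)

∣p∪q∣≤∣p∣+∣q∣ : ∀ {n} (p q : Subset n) → ∣ p ∪ q ∣ ≤ ∣ p ∣ + ∣ q ∣
∣p∪q∣≤∣p∣+∣q∣ []            []            = z≤n
∣p∪q∣≤∣p∣+∣q∣ (inside ∷ p)  (inside ∷ q)  = s≤s (≤-trans (∣p∪q∣≤∣p∣+∣q∣ p q) (+-monoʳ-≤ ∣ p ∣ (n≤1+n ∣ q ∣)))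
∣p∪q∣≤∣p∣+∣q∣ (inside ∷ p)  (outside ∷ q) = s≤s (∣p∪q∣≤∣p∣+∣q∣ p q)
∣p∪q∣≤∣p∣+∣q∣ (outside ∷ p) (inside ∷ q)  = ≤-trans (s≤s (∣p∪q∣≤∣p∣+∣q∣ p q)) (≤-reflexive (sym (+-suc ∣ p ∣ ∣ q ∣)))
∣p∪q∣≤∣p∣+∣q∣ (outside ∷ p) (outside ∷ q) = ∣p∪q∣≤∣p∣+∣q∣ p q

∣p∣≡0⇒x∉p : ∀ {n} {p : Subset n} {x} → ∣ p ∣ ≡ 0 → x ∉ p
∣p∣≡0⇒x∉p {p = inside ∷ p}  ()
∣p∣≡0⇒x∉p {p = outside ∷ p} ∣p∣≡0 (there x∈p) = ∣p∣≡0⇒x∉p ∣p∣≡0 x∈p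

∣p∣≤1⇒x∈p⇒y∈p⇒x≡y : ∀ {n} {p : Subset n} {x y} → ∣ p ∣ ≤ 1 → x ∈ p → y ∈ p → x ≡ y
∣p∣≤1⇒x∈p⇒y∈p⇒x≡y {p = inside ∷ p}  _           here      here      = refl
∣p∣≤1⇒x∈p⇒y∈p⇒x≡y {p = inside ∷ p}  (s≤s ∣p∣≤0) here      (there y) = ⊥-elim (∣p∣≡0⇒x∉p (n≤0⇒n≡0 ∣p∣≤0) y)
∣p∣≤1⇒x∈p⇒y∈p⇒x≡y {p = inside ∷ p}  (s≤s ∣p∣≤0) (there x) _         = ⊥-elim (∣p∣≡0⇒x∉p (n≤0⇒n≡0 ∣p∣≤0) x)
∣p∣≤1⇒x∈p⇒y∈p⇒x≡y {p = outside ∷ p} ∣p∣≤1       (there x) (there y) = cong suc (∣p∣≤1⇒x∈p⇒y∈p⇒x≡y ∣p∣≤1 x y)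

-- Counting subsets

∑ₛ-hasSize≡choose : ∀ {n} k → ∑ₛ {n} (λ A → 𝟙 (hasSize k A)) ≡ choose n k
∑ₛ-hasSize≡choose {zero}  zero    = refl
∑ₛ-hasSize≡choose {zero}  (suc k) = refl
∑ₛ-hasSize≡choose {suc n} zero    = cong₂ _+_ (∑ₛ≡0 {n} λ _ → refl) (∑ₛ-hasSize≡choose {n} zero)
∑ₛ-hasSize≡choose {suc n} (suc k) = cong₂ _+_ (∑ₛ-hasSize≡choose {n} k) (∑ₛ-hasSize≡choose {n} (suc k))

avoids : ∀ {n} → ℕ → Subset n → Subset n → Bool
avoids s W A = hasSize s A ∧ does (∣ A ∩ W ∣ ≟ 0)

∑ₛ-avoids≡choose : ∀ {n} s (W : Subset n) → ∑ₛ (λ A → 𝟙 (avoids s W A)) ≡ choose (n ∸ ∣ W ∣) s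
∑ₛ-avoids≡choose zero    []            = refl
∑ₛ-avoids≡choose (suc s) []            = refl
∑ₛ-avoids≡choose {suc n} s (inside ∷ W) = cong₂ _+_
  (∑ₛ≡0 {n} (λ A → cong 𝟙 (∧-zeroʳ (hasSize s (inside ∷ A)))))
  (∑ₛ-avoids≡choose s W)
∑ₛ-avoids≡choose {suc n} zero    (outside ∷ W) = cong₂ _+_ (∑ₛ≡0 {n} λ _ → refl) (∑ₛ-avoids≡choose zero W)
∑ₛ-avoids≡choose {suc n} (suc s) (outside ∷ W) =
  trans (cong₂ _+_ (∑ₛ-avoids≡choose s W) (∑ₛ-avoids≡choose (suc s) W))
        (cong (λ m → choose m (suc s)) (sym (+-∸-assoc 1 (Subsetₚ.∣p∣≤n W))))

countMeeting : ∀ {n} → ℕ → ℕ → Subset n → ℕ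
countMeeting j s Y = ∑ₛ (λ A → 𝟙 (hasSize s A ∧ does (j ≤? ∣ A ∩ Y ∣)))

countMeeting-beyond-size≡0 : ∀ {n} s (Y : Subset n) → countMeeting (suc s) s Y ≡ 0
countMeeting-beyond-size≡0 s Y = ∑ₛ≡0 term≡0
  where
  term≡0 : ∀ A → 𝟙 (hasSize s A ∧ does (suc s ≤? ∣ A ∩ Y ∣)) ≡ 0
  term≡0 A with hasSize s A in eq
  ... | false = refl
  ... | true  = cong 𝟙 (dec-false (suc s ≤? ∣ A ∩ Y ∣)
                  (<⇒≱ (s≤s (≤-trans (Subsetₚ.∣p∩q∣≤∣p∣ A Y) (≤-reflexive (does≡true⇒ (∣ A ∣ ≟ s) eq))))))

countMeeting-once≤ : ∀ {n} k (Y : Subset n) → countMeeting 1 (suc k) Y ≤ ∣ Y ∣ * choose n k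
countMeeting-once≤ {zero}  k []           = z≤n
countMeeting-once≤ {suc n} k (inside ∷ Y) = +-mono-≤
  (≤-trans (≤-reflexive (trans (∑ₛ-cong {n} (λ A → cong 𝟙 (∧-identityʳ (hasSize k A)))) (∑ₛ-hasSize≡choose k)))
           (choose[n,k]≤choose[1+n,k] n k))
  (≤-trans (countMeeting-once≤ k Y) (*-monoʳ-≤ ∣ Y ∣ (choose[n,k]≤choose[1+n,k] n k)))
countMeeting-once≤ {suc n} zero (outside ∷ Y) =
  ≤-trans (≤-reflexive (cong (_+ countMeeting 1 1 Y) (countMeeting-beyond-size≡0 0 Y))) (countMeeting-once≤ zero Y)
countMeeting-once≤ {suc n} (suc k) (outside ∷ Y) =
  ≤-trans (+-mono-≤ (countMeeting-once≤ k Y) (countMeeting-once≤ (suc k) Y))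
          (≤-reflexive (sym (*-distribˡ-+ ∣ Y ∣ (choose n k) _)))

countMeeting-twice≤ : ∀ {n} k (Y : Subset n) → countMeeting 2 (suc (suc k)) Y ≤ ∣ Y ∣ * ∣ Y ∣ * choose n k
countMeeting-twice≤ {zero}  k []           = z≤n
countMeeting-twice≤ {suc n} k (inside ∷ Y) = begin
  countMeeting 1 (suc k) Y + countMeeting 2 (suc (suc k)) Y
    ≤⟨ +-mono-≤ (countMeeting-once≤ k Y) (countMeeting-twice≤ k Y) ⟩
  y * choose n k + y * y * choose n k
    ≡⟨ *-distribʳ-+ (choose n k) y (y * y) ⟨
  (y + y * y) * choose n k
    ≤⟨ *-mono-≤ y+y²≤[1+y]² (choose[n,k]≤choose[1+n,k] n k) ⟩
  suc y * suc y * choose (suc n) k ∎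
  where
  open ≤-Reasoning
  y = ∣ Y ∣
  y+y²≤[1+y]² : y + y * y ≤ suc y * suc y
  y+y²≤[1+y]² = ≤-trans (m≤n+m (y + y * y) (suc y)) (≤-reflexive (cong (suc y +_) (sym (*-suc y y))))
countMeeting-twice≤ {suc n} zero (outside ∷ Y) =
  ≤-trans (≤-reflexive (cong (_+ countMeeting 2 2 Y) (countMeeting-beyond-size≡0 1 Y))) (countMeeting-twice≤ zero Y)
countMeeting-twice≤ {suc n} (suc k) (outside ∷ Y) =
  ≤-trans (+-mono-≤ (countMeeting-twice≤ k Y) (countMeeting-twice≤ (suc k) Y))
          (≤-reflexive (sym (*-distribˡ-+ (∣ Y ∣ * ∣ Y ∣) (choose n k) _)))

-- Both terms on the left are O(n^(u+1)), whereas choose (n ∸ ∣ W ∣) (u+2) grows like n^(u+2).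
lower-order<choose : ∀ K L y P u → ∃ λ n₀ → ∀ n → n₀ ≤ n → (W : Subset n) → ∣ W ∣ ≤ P →
  K * (n * (y * y * choose n u)) + L * countMeeting 2 (3 + u) W < choose (n ∸ ∣ W ∣) (2 + u)
lower-order<choose K L y P u = proj₁ dominates , bound
  where
  α = K * (y * y) + L * (P * P)
  dominates = choose-dominates-^ α P (suc u)
  regroup : ∀ K L y P n x → K * (n * (y * y * x)) + L * (P * P * (n * x)) ≡ (K * (y * y) + L * (P * P)) * (n * x)
  regroup = solve-∀
  bound : ∀ n → proj₁ dominates ≤ n → (W : Subset n) → ∣ W ∣ ≤ P →
          K * (n * (y * y * choose n u)) + L * countMeeting 2 (3 + u) W < choose (n ∸ ∣ W ∣) (2 + u)
  bound n n₀≤n W ∣W∣≤P = begin-strict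
    K * (n * (y * y * choose n u)) + L * countMeeting 2 (3 + u) W
      ≤⟨ +-mono-≤ (*-monoʳ-≤ K (*-monoʳ-≤ n (*-monoʳ-≤ (y * y) (choose≤^ n u))))
                  (*-monoʳ-≤ L (≤-trans (countMeeting-twice≤ (suc u) W)
                                        (*-mono-≤ (*-mono-≤ ∣W∣≤P ∣W∣≤P) (choose≤^ n (suc u))))) ⟩
    K * (n * (y * y * n ^ u)) + L * (P * P * n ^ suc u)
      ≡⟨ regroup K L y P n (n ^ u) ⟩
    α * n ^ suc u
      <⟨ proj₂ dominates n n₀≤n ⟩
    choose (n ∸ P) (2 + u)
      ≤⟨ choose-monoˡ-≤ (2 + u) (∸-monoʳ-≤ n ∣W∣≤P) ⟩
    choose (n ∸ ∣ W ∣) (2 + u) ∎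
    where open ≤-Reasoning

∑ₛ-equalSizeSupersets≤ : ∀ {n} (A : Subset n) (g : Subset n → Bool) →
  ∑ₛ (λ E → 𝟙 (hasSize ∣ A ∣ E ∧ (g E ∧ does (A ⊆? E)))) ≤ 𝟙 (g A)
∑ₛ-equalSizeSupersets≤ []           g = ≤-reflexive (cong 𝟙 (∧-identityʳ (g [])))
∑ₛ-equalSizeSupersets≤ (inside ∷ A) g =
  ≤-trans (+-mono-≤ (∑ₛ-equalSizeSupersets≤ A (g ∘ (inside ∷_))) (≤-reflexive (∑ₛ≡0 term≡0)))
          (≤-reflexive (+-identityʳ _))
  where
  term≡0 : ∀ E → 𝟙 (hasSize (suc ∣ A ∣) (outside ∷ E) ∧ (g (outside ∷ E) ∧ false)) ≡ 0
  term≡0 E = 𝟙[a∧b∧c]≡0 (hasSize (suc ∣ A ∣) (outside ∷ E)) (g (outside ∷ E)) false λ ()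
∑ₛ-equalSizeSupersets≤ (outside ∷ A) g =
  +-mono-≤ (≤-reflexive (∑ₛ≡0 term≡0)) (∑ₛ-equalSizeSupersets≤ A (g ∘ (outside ∷_)))
  where
  term≡0 : ∀ E → 𝟙 (hasSize ∣ A ∣ (inside ∷ E) ∧ (g (inside ∷ E) ∧ does (A ⊆? E))) ≡ 0
  term≡0 E = 𝟙[a∧b∧c]≡0 _ _ _ λ A⊆E → dec-false (suc ∣ E ∣ ≟ ∣ A ∣)
    λ 1+∣E∣≡∣A∣ → <⇒≱ (≤-reflexive 1+∣E∣≡∣A∣) (Subsetₚ.p⊆q⇒∣p∣≤∣q∣ (does≡true⇒ (A ⊆? E) A⊆E))

fitEdge : ∀ {n} → ℕ → Subset n → Subset n → Subset n → Bool
fitEdge r T A E = hasSize r E ∧ (does (∣ E ∩ T ∣ ≟ 1) ∧ does (A ⊆? E))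

fitSum≡∑ₛ : ∀ {k n} r (H : Family k n) T A → fitSum r H T A ≡ ∑ₛ (λ E → 𝟙 (fitEdge r T A E) * mult H E)
fitSum≡∑ₛ r H T A = sum-filter-allSubsets (fitEdge r T A) (mult H)

-- Such an E is A together with one vertex of T.
∑ₛ-fitEdge≤∣T∣ : ∀ {n} (A T : Subset n) → ∣ A ∩ T ∣ ≡ 0 → ∑ₛ (λ E → 𝟙 (fitEdge (suc ∣ A ∣) T A E)) ≤ ∣ T ∣
∑ₛ-fitEdge≤∣T∣ []            []            _       = z≤n
∑ₛ-fitEdge≤∣T∣ (inside ∷ A) (outside ∷ T) A∩T≡∅ =
  ≤-trans (+-mono-≤ (∑ₛ-fitEdge≤∣T∣ A T A∩T≡∅) (≤-reflexive (∑ₛ≡0 term≡0))) (≤-reflexive (+-identityʳ _))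
  where
  term≡0 : ∀ E → 𝟙 (hasSize (suc (suc ∣ A ∣)) (outside ∷ E) ∧ (does (∣ E ∩ T ∣ ≟ 1) ∧ false)) ≡ 0
  term≡0 E = 𝟙[a∧b∧c]≡0 (hasSize (suc (suc ∣ A ∣)) (outside ∷ E)) (does (∣ E ∩ T ∣ ≟ 1)) false λ ()
∑ₛ-fitEdge≤∣T∣ (outside ∷ A) (inside ∷ T)  A∩T≡∅ = +-mono-≤
  (≤-trans (∑ₛ-equalSizeSupersets≤ A (λ E → does (∣ E ∩ T ∣ ≟ 0))) (𝟙≤1 _))
  (∑ₛ-fitEdge≤∣T∣ A T A∩T≡∅)
∑ₛ-fitEdge≤∣T∣ (outside ∷ A) (outside ∷ T) A∩T≡∅ = +-mono-≤
  (≤-trans (∑ₛ-equalSizeSupersets≤ A (λ E → does (∣ E ∩ T ∣ ≟ 1)))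
           (≤-reflexive (cong (λ m → 𝟙 (does (m ≟ 1))) A∩T≡∅)))
  (∑ₛ-fitEdge≤∣T∣ A T A∩T≡∅)

fitSum≤k*∣T∣ : ∀ {k n} (H : Family k n) (A T : Subset n) → ∣ A ∩ T ∣ ≡ 0 → fitSum (suc ∣ A ∣) H T A ≤ k * ∣ T ∣
fitSum≤k*∣T∣ {k} H A T A∩T≡∅ = begin
  fitSum (suc ∣ A ∣) H T A                  ≡⟨ fitSum≡∑ₛ _ H T A ⟩
  ∑ₛ (λ E → 𝟙 (fitEdge _ T A E) * mult H E) ≤⟨ ∑ₛ-mono-≤ (λ E → ≤-trans (*-monoʳ-≤ (𝟙 (fitEdge _ T A E)) (mult≤k H E))
                                                                     (≤-reflexive (*-comm _ k))) ⟩
  ∑ₛ (λ E → k * 𝟙 (fitEdge _ T A E))        ≡⟨ ∑ₛ-distribˡ-* k (λ E → 𝟙 (fitEdge _ T A E)) ⟩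
  k * ∑ₛ (λ E → 𝟙 (fitEdge _ T A E))        ≤⟨ *-monoʳ-≤ k (∑ₛ-fitEdge≤∣T∣ A T A∩T≡∅) ⟩
  k * ∣ T ∣                                 ∎
  where open ≤-Reasoning

-- Greedy sunflowers

Sunflower : ∀ {n} → (Subset n → Bool) → Fin n → ℕ → Set
Sunflower {n} F w t = Σ (Fin t → Subset n) λ S →
  (∀ i → F (S i) ≡ true × w ∈ S i) × (∀ i j → i ≢ j → S i ∩ S j ≡ ⁅ w ⁆)

𝟙a<𝟙b*𝟙c⇒ : ∀ a b c → 𝟙 a < 𝟙 b * 𝟙 c → a ≡ false × b ≡ true × c ≡ true
𝟙a<𝟙b*𝟙c⇒ false true  true  _ = refl , refl , refl
𝟙a<𝟙b*𝟙c⇒ true  true  true  (s≤s ())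
𝟙a<𝟙b*𝟙c⇒ _     false _     ()
𝟙a<𝟙b*𝟙c⇒ _     true  false ()

-- Petals are added greedily: the core (the petals so far and w) has at most 1 + t s vertices, and fewer
-- than deg_F(w) sets of size s meet it twice, so some member of F through w meets it only in w.
sunflower-greedy : ∀ {n} s t D (F : Subset n → Bool) (w : Fin n) →
  (∀ A → F A ≡ true → ∣ A ∣ ≡ s) →
  (∀ Y → ∣ Y ∣ ≤ suc (t * s) → countMeeting 2 s Y ≤ D) →
  D < ∑ₛ (λ A → 𝟙 (F A) * 𝟙 (lookup A w)) →
  Sunflower F w t
sunflower-greedy {n} s t D F w F⇒size few-meet-twice D<deg = grow t ≤-refl
  where
  core : ∀ {j} → (Fin j → Subset n) → Subset n
  core {zero}  S = ⁅ w ⁆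
  core {suc j} S = S zero ∪ core (S ∘ suc)

  ∣core∣≤ : ∀ {j} (S : Fin j → Subset n) → (∀ i → ∣ S i ∣ ≡ s) → ∣ core S ∣ ≤ suc (j * s)
  ∣core∣≤ {zero}  S _     = ≤-reflexive (Subsetₚ.∣⁅x⁆∣≡1 w)
  ∣core∣≤ {suc j} S sizes = begin
    ∣ S zero ∪ core (S ∘ suc) ∣        ≤⟨ ∣p∪q∣≤∣p∣+∣q∣ (S zero) (core (S ∘ suc)) ⟩
    ∣ S zero ∣ + ∣ core (S ∘ suc) ∣    ≤⟨ +-mono-≤ (≤-reflexive (sizes zero)) (∣core∣≤ (S ∘ suc) (sizes ∘ suc)) ⟩
    s + suc (j * s)                    ≡⟨ +-suc s (j * s) ⟩
    suc (s + j * s)                    ∎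
    where open ≤-Reasoning

  petal⊆core : ∀ {j} (S : Fin j → Subset n) i → S i ⊆ core S
  petal⊆core {suc j} S zero    = Subsetₚ.p⊆p∪q (core (S ∘ suc))
  petal⊆core {suc j} S (suc i) = Subsetₚ.q⊆p∪q (S zero) (core (S ∘ suc)) ∘ petal⊆core (S ∘ suc) i

  w∈core : ∀ {j} (S : Fin j → Subset n) → w ∈ core S
  w∈core {zero}  S = Subsetₚ.x∈⁅x⁆ w
  w∈core {suc j} S = Subsetₚ.q⊆p∪q (S zero) (core (S ∘ suc)) (w∈core (S ∘ suc))

  fresh : ∀ Y → ∣ Y ∣ ≤ suc (t * s) → ∃ λ A → F A ≡ true × w ∈ A × ∣ A ∩ Y ∣ ≤ 1
  fresh Y ∣Y∣≤ = A , FA , Vecₚ.lookup⇒[]= w A w∈A , ≤-pred (≰⇒> (does≡false⇒¬ (2 ≤? ∣ A ∩ Y ∣) not-twice))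
    where
    found = ∑ₛ-pigeonhole _ _ (<-≤-trans (s≤s (few-meet-twice Y ∣Y∣≤)) D<deg)
    A = proj₁ found
    picked = 𝟙a<𝟙b*𝟙c⇒ _ _ _ (proj₂ found)
    FA = proj₁ (proj₂ picked)
    w∈A = proj₂ (proj₂ picked)
    not-twice : does (2 ≤? ∣ A ∩ Y ∣) ≡ false
    not-twice = trans (cong (_∧ does (2 ≤? ∣ A ∩ Y ∣)) (sym (dec-true (∣ A ∣ ≟ s) (F⇒size A FA)))) (proj₁ picked)

  grow : ∀ j → j ≤ t → Sunflower F w j
  grow zero    _     = (λ ()) , (λ ()) , (λ ())
  grow (suc j) j<t with grow j (<⇒≤ j<t)
  ... | S , members , pairwise = S′ , members′ , pairwise′
    where
    ∣core∣≤1+ts = ≤-trans (∣core∣≤ S (λ i → F⇒size (S i) (proj₁ (members i)))) (s≤s (*-monoˡ-≤ s (<⇒≤ j<t)))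
    new = fresh (core S) ∣core∣≤1+ts
    A = proj₁ new
    w∈A = proj₁ (proj₂ (proj₂ new))
    A∩Sᵢ≡⁅w⁆ : ∀ i → A ∩ S i ≡ ⁅ w ⁆
    A∩Sᵢ≡⁅w⁆ i = Subsetₚ.⊆-antisym ⊆⁅w⁆ ⁅w⁆⊆
      where
      ⊆⁅w⁆ : A ∩ S i ⊆ ⁅ w ⁆
      ⊆⁅w⁆ x∈ = let x∈A , x∈Sᵢ = Subsetₚ.x∈p∩q⁻ A (S i) x∈ in
        subst (_∈ ⁅ w ⁆)
              (∣p∣≤1⇒x∈p⇒y∈p⇒x≡y (proj₂ (proj₂ (proj₂ new)))
                 (Subsetₚ.x∈p∩q⁺ (w∈A , w∈core S)) (Subsetₚ.x∈p∩q⁺ (x∈A , petal⊆core S i x∈Sᵢ)))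
              (Subsetₚ.x∈⁅x⁆ w)
      ⁅w⁆⊆ : ⁅ w ⁆ ⊆ A ∩ S i
      ⁅w⁆⊆ x∈ = subst (_∈ A ∩ S i) (sym (Subsetₚ.x∈⁅y⁆⇒x≡y w x∈)) (Subsetₚ.x∈p∩q⁺ (w∈A , proj₂ (members i)))
    S′ : Fin (suc j) → Subset n
    S′ zero    = A
    S′ (suc i) = S i
    members′ : ∀ i → F (S′ i) ≡ true × w ∈ S′ i
    members′ zero    = proj₁ (proj₂ new) , w∈A
    members′ (suc i) = members i
    pairwise′ : ∀ i i′ → i ≢ i′ → S′ i ∩ S′ i′ ≡ ⁅ w ⁆
    pairwise′ zero    zero     0≢0 = ⊥-elim (0≢0 refl)
    pairwise′ zero    (suc i′) _   = A∩Sᵢ≡⁅w⁆ i′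
    pairwise′ (suc i) zero     _   = trans (Subsetₚ.∩-comm (S i) A) (A∩Sᵢ≡⁅w⁆ i)
    pairwise′ (suc i) (suc i′) i≢i′ = pairwise i i′ (i≢i′ ∘ cong suc)

-- Double counting fitting sets

module Fitting (ℓ : ℕ) {k n} (H : Family k n) (s t : ℕ) (T B : Subset n) (∣T∣≡t : ∣ T ∣ ≡ t) where

  c : ℕ
  c = ℓ C 2 ∸ 1

  W : Subset n
  W = T ∪ B

  -- fits A: A ∈ H(T) (for r = suc s) and A avoids B.
  fits : Subset n → Bool
  fits A = avoids s W A ∧ does (t * c ≤? fitSum (suc s) H T A)

  #avoiding #fitting #crossing : ℕ
  #avoiding = ∑ₛ (λ A → 𝟙 (avoids s W A))
  #fitting  = ∑ₛ (λ A → 𝟙 (fits A))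
  #crossing = countMeeting 2 (suc s) W

  meetsWOnceInT : Subset n → Bool
  meetsWOnceInT E = hasSize (suc s) E ∧ (does (∣ E ∩ T ∣ ≟ 1) ∧ does (∣ E ∩ W ∣ ≟ 1))

  ∣E∩T∣≤∣E∩W∣ : ∀ E → ∣ E ∩ T ∣ ≤ ∣ E ∩ W ∣
  ∣E∩T∣≤∣E∩W∣ E = ≤-trans (m≤m+n ∣ E ∩ T ∣ _) (≤-reflexive (∣p∩q∣+∣[p─q]∩[q∪r]∣≡∣p∩[q∪r]∣ E T B))

  -- An r-set E meeting T in a vertices is counted a·m(E) times; unless it meets W only once, it meets W
  -- twice, and then a·m(E) ≤ t k.
  ∑ₛ-∣E∩T∣*mult≤ : ∑ₛ (λ E → ∣ E ∩ T ∣ * (𝟙 (hasSize (suc s) E) * mult H E))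
                   ≤ ∑ₛ (λ E → 𝟙 (meetsWOnceInT E) * mult H E) + k * t * #crossing
  ∑ₛ-∣E∩T∣*mult≤ = ≤-trans (∑ₛ-mono-≤ λ E →
      charge (hasSize (suc s) E) ∣ E ∩ T ∣ ∣ E ∩ W ∣ (mult H E) (∣E∩T∣≤∣E∩W∣ E)
             (≤-trans (Subsetₚ.∣p∩q∣≤∣q∣ E T) (≤-reflexive ∣T∣≡t)) (mult≤k H E))
    (≤-reflexive (trans (∑ₛ-distrib-+ {n} _ _) (cong₂ _+_ refl (∑ₛ-distribˡ-* {n} (k * t) _))))
    where
    charge : ∀ h a e m → a ≤ e → a ≤ t → m ≤ k →
      a * (𝟙 h * m) ≤ 𝟙 (h ∧ (does (a ≟ 1) ∧ does (e ≟ 1))) * m + k * t * 𝟙 (h ∧ does (2 ≤? e))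
    charge false a             e             m _ _ _ = ≤-trans (≤-reflexive (*-zeroʳ a)) z≤n
    charge true  zero          e             m _ _ _ = z≤n
    charge true  (suc a)       zero          m () _ _
    charge true  (suc (suc a)) 1             m (s≤s ()) _ _
    charge true  1             1             m _ _ _ = ≤-trans (≤-reflexive (+-identityʳ _)) (m≤m+n _ _)
    charge true  1             (suc (suc e)) m _ 1≤t m≤k = begin
      1 * (1 * m) ≡⟨ trans (*-identityˡ _) (*-identityˡ m) ⟩
      m           ≤⟨ m≤k ⟩
      k           ≤⟨ m≤m*n k t {{>-nonZero 1≤t}} ⟩
      k * t       ≡⟨ *-identityʳ (k * t) ⟨
      k * t * 1   ∎
      where open ≤-Reasoning
    charge true  (suc (suc a)) (suc (suc e)) m _ a≤t m≤k = begin
      suc (suc a) * (1 * m) ≡⟨ cong (suc (suc a) *_) (*-identityˡ m) ⟩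
      suc (suc a) * m       ≤⟨ *-mono-≤ a≤t m≤k ⟩
      t * k                 ≡⟨ trans (*-comm t k) (sym (*-identityʳ (k * t))) ⟩
      k * t * 1             ∎
      where open ≤-Reasoning

  ∑ₛ-meetsWOnceInT≤∑ₛ-fitSum : ∑ₛ (λ E → 𝟙 (meetsWOnceInT E) * mult H E)
                               ≤ ∑ₛ (λ A → 𝟙 (avoids s W A) * fitSum (suc s) H T A)
  ∑ₛ-meetsWOnceInT≤∑ₛ-fitSum = ≤-trans (∑ₛ-mono-≤ term≤) (≤-reflexive (sym swap))
    where
    summand : Subset n → Subset n → ℕ
    summand A E = 𝟙 (avoids s W A) * (𝟙 (fitEdge (suc s) T A E) * mult H E)
    swap : ∑ₛ (λ A → 𝟙 (avoids s W A) * fitSum (suc s) H T A) ≡ ∑ₛ (λ E → ∑ₛ (λ A → summand A E))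
    swap = trans (∑ₛ-cong λ A → trans (cong (𝟙 (avoids s W A) *_) (fitSum≡∑ₛ (suc s) H T A))
                                      (sym (∑ₛ-distribˡ-* {n} (𝟙 (avoids s W A)) _)))
                 (∑ₛ-comm summand)
    term≤ : ∀ E → 𝟙 (meetsWOnceInT E) * mult H E ≤ ∑ₛ (λ A → summand A E)
    term≤ E with meetsWOnceInT E in once
    ... | false = z≤n
    ... | true  = ≤-trans (≤-reflexive (sym summand≡)) (term≤∑ₛ (λ A → summand A E) (E ─ T))
      where
      sized = ∧-conicalˡ (hasSize (suc s) E) _ once
      meets = ∧-conicalʳ (hasSize (suc s) E) _ once
      ∣E∩T∣≡1 = does≡true⇒ (∣ E ∩ T ∣ ≟ 1) (∧-conicalˡ (does (∣ E ∩ T ∣ ≟ 1)) _ meets)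
      ∣E∩W∣≡1 = does≡true⇒ (∣ E ∩ W ∣ ≟ 1) (∧-conicalʳ (does (∣ E ∩ T ∣ ≟ 1)) _ meets)
      ∣E─T∣≡s : ∣ E ─ T ∣ ≡ s
      ∣E─T∣≡s = suc-injective (trans (cong (_+ ∣ E ─ T ∣) (sym ∣E∩T∣≡1))
                                     (trans (∣p∩q∣+∣p─q∣≡∣p∣ E T) (does≡true⇒ (∣ E ∣ ≟ suc s) sized)))
      ∣[E─T]∩W∣≡0 : ∣ (E ─ T) ∩ W ∣ ≡ 0
      ∣[E─T]∩W∣≡0 = suc-injective (trans (cong (_+ ∣ (E ─ T) ∩ W ∣) (sym ∣E∩T∣≡1))
                                         (trans (∣p∩q∣+∣[p─q]∩[q∪r]∣≡∣p∩[q∪r]∣ E T B) ∣E∩W∣≡1))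
      avoids-E─T : avoids s W (E ─ T) ≡ true
      avoids-E─T = ∧-intro (dec-true (∣ E ─ T ∣ ≟ s) ∣E─T∣≡s) (dec-true (∣ (E ─ T) ∩ W ∣ ≟ 0) ∣[E─T]∩W∣≡0)
      fitEdge-E : fitEdge (suc s) T (E ─ T) E ≡ true
      fitEdge-E = ∧-intro sized (∧-intro (dec-true (∣ E ∩ T ∣ ≟ 1) ∣E∩T∣≡1) (dec-true ((E ─ T) ⊆? E) (p─q⊆p E T)))
      summand≡ : summand (E ─ T) E ≡ 1 * mult H E
      summand≡ = trans (cong₂ (λ a f → 𝟙 a * (𝟙 f * mult H E)) avoids-E─T fitEdge-E) (*-identityˡ (1 * mult H E))

  fitSum≤k*t : ∀ A → avoids s W A ≡ true → fitSum (suc s) H T A ≤ k * t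
  fitSum≤k*t A avoid = subst₂ (λ m t′ → fitSum (suc m) H T A ≤ k * t′)
    (does≡true⇒ (∣ A ∣ ≟ s) (∧-conicalˡ (hasSize s A) _ avoid)) ∣T∣≡t
    (fitSum≤k*∣T∣ H A T (n≤0⇒n≡0 (≤-trans (∣E∩T∣≤∣E∩W∣ A) (≤-reflexive ∣A∩W∣≡0))))
    where
    ∣A∩W∣≡0 = does≡true⇒ (∣ A ∩ W ∣ ≟ 0) (∧-conicalʳ (hasSize s A) _ avoid)

  ∑ₛ-fitSum+#avoiding≤ : ∑ₛ (λ A → 𝟙 (avoids s W A) * fitSum (suc s) H T A) + #avoiding
                         ≤ t * c * #avoiding + (k * t + 1) * #fitting
  ∑ₛ-fitSum+#avoiding≤ = begin
    ∑ₛ (λ A → 𝟙 (avoids s W A) * fitSum (suc s) H T A) + #avoiding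
      ≡⟨ ∑ₛ-distrib-+ {n} _ _ ⟨
    ∑ₛ (λ A → 𝟙 (avoids s W A) * fitSum (suc s) H T A + 𝟙 (avoids s W A))
      ≤⟨ ∑ₛ-mono-≤ (λ A → threshold (avoids s W A) (fitSum (suc s) H T A) (t * c) (k * t) (fitSum≤k*t A)) ⟩
    ∑ₛ (λ A → t * c * 𝟙 (avoids s W A) + (k * t + 1) * 𝟙 (fits A))
      ≡⟨ ∑ₛ-distrib-+ {n} _ _ ⟩
    ∑ₛ (λ A → t * c * 𝟙 (avoids s W A)) + ∑ₛ (λ A → (k * t + 1) * 𝟙 (fits A))
      ≡⟨ cong₂ _+_ (∑ₛ-distribˡ-* {n} (t * c) _) (∑ₛ-distribˡ-* {n} (k * t + 1) _) ⟩
    t * c * #avoiding + (k * t + 1) * #fitting ∎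
    where
    open ≤-Reasoning
    threshold : ∀ a f θ K → (a ≡ true → f ≤ K) → 𝟙 a * f + 𝟙 a ≤ θ * 𝟙 a + (K + 1) * 𝟙 (a ∧ does (θ ≤? f))
    threshold false f θ K _   = z≤n
    threshold true  f θ K f≤K with does (θ ≤? f) in θ≤?f
    ... | true  = begin
      1 * f + 1           ≡⟨ cong (_+ 1) (*-identityˡ f) ⟩
      f + 1               ≤⟨ +-monoˡ-≤ 1 (f≤K refl) ⟩
      K + 1               ≤⟨ m≤n+m (K + 1) (θ * 1) ⟩
      θ * 1 + (K + 1)     ≡⟨ cong (θ * 1 +_) (*-identityʳ (K + 1)) ⟨
      θ * 1 + (K + 1) * 1 ∎
    ... | false = begin
      1 * f + 1           ≡⟨ trans (cong (_+ 1) (*-identityˡ f)) (+-comm f 1) ⟩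
      suc f               ≤⟨ ≰⇒> (does≡false⇒¬ (θ ≤? f) θ≤?f) ⟩
      θ                   ≡⟨ trans (sym (*-identityʳ θ)) (sym (+-identityʳ (θ * 1))) ⟩
      θ * 1 + 0           ≡⟨ cong (θ * 1 +_) (*-zeroʳ (K + 1)) ⟨
      θ * 1 + (K + 1) * 0 ∎

  #avoiding≤ : ∀ M → #avoiding ≤ M → (∀ v → c * M ≤ multV (suc s) H v) →
               #avoiding ≤ (k * t + 1) * #fitting + k * t * #crossing
  #avoiding≤ M #avoiding≤M degree≥ = +-cancelˡ-≤ (t * c * #avoiding) _ _ (begin
    t * c * #avoiding + #avoiding
      ≤⟨ +-monoˡ-≤ #avoiding (≤-trans (≤-reflexive (*-assoc t c #avoiding)) (*-monoʳ-≤ t (*-monoʳ-≤ c #avoiding≤M))) ⟩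
    t * (c * M) + #avoiding
      ≤⟨ +-monoˡ-≤ #avoiding degreeSum≤ ⟩
    ∑fitSum + k * t * #crossing + #avoiding
      ≡⟨ [x+y]+z≡[x+z]+y ∑fitSum _ _ ⟩
    ∑fitSum + #avoiding + k * t * #crossing
      ≤⟨ +-monoˡ-≤ (k * t * #crossing) ∑ₛ-fitSum+#avoiding≤ ⟩
    t * c * #avoiding + (k * t + 1) * #fitting + k * t * #crossing
      ≡⟨ +-assoc (t * c * #avoiding) _ _ ⟩
    t * c * #avoiding + ((k * t + 1) * #fitting + k * t * #crossing) ∎)
    where
    open ≤-Reasoning
    ∑fitSum = ∑ₛ (λ A → 𝟙 (avoids s W A) * fitSum (suc s) H T A)
    degreeSum≤ : t * (c * M) ≤ ∑fitSum + k * t * #crossing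
    degreeSum≤ = begin
      t * (c * M)
        ≡⟨ trans (cong (_* (c * M)) (trans (sym ∣T∣≡t) (sym (∑ᵢ-𝟙-lookup≡∣ T ∣)))) (sym (∑ᵢ-distribʳ-* {n} (c * M) _)) ⟩
      ∑ᵢ (λ v → 𝟙 (lookup T v) * (c * M))
        ≤⟨ ∑ᵢ-mono-≤ (λ v → *-monoʳ-≤ (𝟙 (lookup T v)) (degree≥ v)) ⟩
      ∑ᵢ (λ v → 𝟙 (lookup T v) * multV (suc s) H v)
        ≡⟨ ∑ᵢ-multV≡∑ₛ (suc s) H T ⟩
      ∑ₛ (λ E → ∣ E ∩ T ∣ * (𝟙 (hasSize (suc s) E) * mult H E))
        ≤⟨ ∑ₛ-∣E∩T∣*mult≤ ⟩
      ∑ₛ (λ E → 𝟙 (meetsWOnceInT E) * mult H E) + k * t * #crossing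
        ≤⟨ +-monoˡ-≤ (k * t * #crossing) ∑ₛ-meetsWOnceInT≤∑ₛ-fitSum ⟩
      ∑fitSum + k * t * #crossing ∎

  n*D<#fitting : ∀ M D → #avoiding ≤ M → (∀ v → c * M ≤ multV (suc s) H v) →
                 (k * t + 1) * (n * D) + k * t * #crossing < #avoiding → n * D < #fitting
  n*D<#fitting M D #avoiding≤M degree≥ small<#avoiding = *-cancelˡ-< (k * t + 1) (n * D) #fitting
    (+-cancelʳ-< (k * t * #crossing) _ _ (<-≤-trans small<#avoiding (#avoiding≤ M #avoiding≤M degree≥)))

  fits⇒avoids : ∀ A → fits A ≡ true → avoids s W A ≡ true
  fits⇒avoids A = ∧-conicalˡ (avoids s W A) _

  fits⇒size : ∀ A → fits A ≡ true → ∣ A ∣ ≡ s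
  fits⇒size A fit = does≡true⇒ (∣ A ∣ ≟ s) (∧-conicalˡ (hasSize s A) _ (fits⇒avoids A fit))

  fits⇒disjoint : ∀ A → fits A ≡ true → Disjoint A T × Disjoint A B
  fits⇒disjoint A fit = (λ x x∈A x∈T → x∉A∩W (Subsetₚ.x∈p∩q⁺ (x∈A , Subsetₚ.x∈p∪q⁺ (inj₁ x∈T))))
                      , (λ x x∈A x∈B → x∉A∩W (Subsetₚ.x∈p∩q⁺ (x∈A , Subsetₚ.x∈p∪q⁺ (inj₂ x∈B))))
    where
    x∉A∩W : ∀ {x} → x ∉ A ∩ W
    x∉A∩W = ∣p∣≡0⇒x∉p (does≡true⇒ (∣ A ∩ W ∣ ≟ 0) (∧-conicalʳ (hasSize s A) _ (fits⇒avoids A fit)))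

  fits⇒InHT : ∀ A → fits A ≡ true → InHT ℓ (suc s) t H T A
  fits⇒InHT A fit = fits⇒size A fit , proj₁ (fits⇒disjoint A fit)
                  , does≡true⇒ (t * c ≤? fitSum (suc s) H T A) (∧-conicalʳ (avoids s W A) _ fit)

  sunflower-of-fitting : .{{NonZero s}} → ∀ D → (∀ Y → ∣ Y ∣ ≤ suc (t * s) → countMeeting 2 s Y ≤ D) →
                         n * D < #fitting → ∃ λ w → Sunflower fits w t
  sunflower-of-fitting D few-meet-twice n*D<#fitting =
    w , sunflower-greedy s t D fits w fits⇒size few-meet-twice D<deg
    where
    deg : Fin n → ℕ
    deg w = ∑ₛ (λ A → 𝟙 (fits A) * 𝟙 (lookup A w))
    ∑deg≡s*#fitting : ∑ᵢ deg ≡ s * #fitting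
    ∑deg≡s*#fitting = begin
      ∑ᵢ deg                                            ≡⟨ ∑ᵢ-∑ₛ-comm (λ w A → 𝟙 (fits A) * 𝟙 (lookup A w)) ⟩
      ∑ₛ (λ A → ∑ᵢ (λ w → 𝟙 (fits A) * 𝟙 (lookup A w))) ≡⟨ ∑ₛ-cong per-set ⟩
      ∑ₛ (λ A → s * 𝟙 (fits A))                         ≡⟨ ∑ₛ-distribˡ-* s (λ A → 𝟙 (fits A)) ⟩
      s * #fitting                                      ∎
      where
      open ≡-Reasoning
      per-set : ∀ A → ∑ᵢ (λ w → 𝟙 (fits A) * 𝟙 (lookup A w)) ≡ s * 𝟙 (fits A)
      per-set A = begin
        ∑ᵢ (λ w → 𝟙 (fits A) * 𝟙 (lookup A w)) ≡⟨ ∑ᵢ-cong (λ w → *-comm (𝟙 (fits A)) (𝟙 (lookup A w))) ⟩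
        ∑ᵢ (λ w → 𝟙 (lookup A w) * 𝟙 (fits A)) ≡⟨ ∑ᵢ-distribʳ-* (𝟙 (fits A)) (λ w → 𝟙 (lookup A w)) ⟩
        ∑ᵢ (λ w → 𝟙 (lookup A w)) * 𝟙 (fits A) ≡⟨ cong (_* 𝟙 (fits A)) (∑ᵢ-𝟙-lookup≡∣ A ∣) ⟩
        ∣ A ∣ * 𝟙 (fits A)                     ≡⟨ size*𝟙 ⟩
        s * 𝟙 (fits A)                         ∎
        where
        size*𝟙 : ∣ A ∣ * 𝟙 (fits A) ≡ s * 𝟙 (fits A)
        size*𝟙 with fits A in fit
        ... | true  = cong (_* 1) (fits⇒size A fit)
        ... | false = trans (*-zeroʳ ∣ A ∣) (sym (*-zeroʳ s))
    w,D<deg = ∑ᵢ-pigeonhole D deg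
      (<-≤-trans n*D<#fitting (≤-trans (m≤n*m #fitting s) (≤-reflexive (sym ∑deg≡s*#fitting))))
    w = proj₁ w,D<deg
    D<deg = proj₂ w,D<deg

  Sunflower⇒SunflowerInHT : 2 ≤ s → 1 ≤ t → ∀ w → Sunflower fits w t → SunflowerInHT ℓ (suc s) t H T B
  Sunflower⇒SunflowerInHT 2≤s 1≤t w (S , members , pairwise) = w , S , w∉T , injective , petal , pairwise
    where
    fit : ∀ j → fits (S j) ≡ true
    fit j = proj₁ (members j)
    petal : ∀ j → InHT ℓ (suc s) t H T (S j) × w ∈ S j × Disjoint (S j) B
    petal j = fits⇒InHT (S j) (fit j) , proj₂ (members j) , proj₂ (fits⇒disjoint (S j) (fit j))
    w∉T : w ∉ T
    w∉T = let j = fromℕ< 1≤t in proj₁ (fits⇒disjoint (S j) (fit j)) w (proj₂ (members j))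
    injective : ∀ j j′ → S j ≡ S j′ → j ≡ j′
    injective j j′ Sⱼ≡Sⱼ′ with j Finₚ.≟ j′
    ... | yes j≡j′ = j≡j′
    ... | no  j≢j′ = contradiction s≡1 (>⇒≢ 2≤s)
      where
      Sⱼ≡⁅w⁆ : S j ≡ ⁅ w ⁆
      Sⱼ≡⁅w⁆ = trans (sym (Subsetₚ.∩-idem (S j))) (trans (cong (S j ∩_) Sⱼ≡Sⱼ′) (pairwise j j′ j≢j′))
      s≡1 : s ≡ 1
      s≡1 = trans (sym (fits⇒size (S j) (fit j))) (trans (cong ∣_∣ Sⱼ≡⁅w⁆) (Subsetₚ.∣⁅x⁆∣≡1 w))

lemma3p1 : (ℓ r k t b : ℕ) → ℓ ≥ r → r ≥ 3 → (ℓ C 2) ≤ k → 2 * k + 1 < ℓ * ℓ → t ≥ 1 →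
    Σ ℕ λ n₀ → (n : ℕ) → n ≥ n₀ →
      (H : Family k n) → Uniform r H →
      ¬ RainbowExpansion ℓ r H →
      ((v : Fin n) → multV r H v ≥ ((ℓ C 2) ∸ 1) * ((n ∸ 1) C (r ∸ 1))) →
      (T B : Subset n) → ∣ T ∣ ≡ t → ∣ B ∣ ≡ b →
      SunflowerInHT ℓ r t H T B
lemma3p1 ℓ .(3 + u) k t b _ (s≤s (s≤s (s≤s (z≤n {u})))) _ _ 1≤t =
  proj₁ lower-order , λ n n₀≤n H _ _ degree≥ T B ∣T∣≡t ∣B∣≡b →
    let open Fitting ℓ H (2 + u) t T B ∣T∣≡t
        D = y * y * choose n u
        ∣W∣≤t+b = ≤-trans (∣p∪q∣≤∣p∣+∣q∣ T B) (≤-reflexive (cong₂ _+_ ∣T∣≡t ∣B∣≡b))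
        1≤∣W∣ = ≤-trans 1≤t (≤-trans (≤-reflexive (sym ∣T∣≡t)) (Subsetₚ.∣p∣≤∣p∪q∣ T B))
        #avoiding≡ = ∑ₛ-avoids≡choose (2 + u) W
        #avoiding≤M = ≤-trans (≤-reflexive #avoiding≡)
                              (≤-trans (choose-monoˡ-≤ (2 + u) (∸-monoʳ-≤ n 1≤∣W∣)) (≤-reflexive (choose≡C (n ∸ 1) (2 + u))))
        many-fitting = n*D<#fitting _ D #avoiding≤M degree≥
                         (≤-trans (proj₂ lower-order n n₀≤n W ∣W∣≤t+b) (≤-reflexive (sym #avoiding≡)))
        few-meet-twice = λ Y ∣Y∣≤y → ≤-trans (countMeeting-twice≤ u Y) (*-monoˡ-≤ (choose n u) (*-mono-≤ ∣Y∣≤y ∣Y∣≤y))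
        w , sunflower = sunflower-of-fitting D few-meet-twice many-fitting
    in Sunflower⇒SunflowerInHT (s≤s (s≤s z≤n)) 1≤t w sunflower
  where
  y = suc (t * (2 + u))
  lower-order = lower-order<choose (k * t + 1) (k * t) y (t + b) u
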